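{- Let $n > 1$ be an integer and $p \leq n$ a prime. Then $$\sum_{\nu \geq 1} \left\{\frac{n}{p^\nu}\right\} \leq 1 \quad \iff \quad \mathrm{ord}_p \binom{n}{k} \geq 1 \text{ for all integers } k \text{ with } 0 < k < n \text{ and } p-1 \mid k.$$
   Context: $\{x\} = x - \lfloor x \rfloor$ denotes the fractional part, and $\mathrm{ord}_p$ denotes the $p$-adic valuation. -}

module Defs where

open import Data.Nat using (ℕ; zero; suc; _^_; NonZero)
open import Data.Nat.Properties using (m^n≢0)
open import Data.Integer using (+_)
open import Data.Rational using (ℚ; 0ℚ; _+_; _-_; _/_; floor)

frac : ℚ → ℚ
frac x = x - (floor x / 1)

term : (n p : ℕ) .{{_ : NonZero p}} → ℕ → ℚ
term n p ν = frac (_/_ (+ n) (p ^ ν) {{m^n≢0 p ν}})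

partialSum : (n p : ℕ) .{{_ : NonZero p}} → ℕ → ℚ
partialSum n p zero    = 0ℚ
partialSum n p (suc N) = partialSum n p N + term n p (suc N)

{-# OPTIONS --safe #-}
-- Write s(n) for the sum of the base-p digits of n and s_N(n) for the sum of its N lowest
-- digits.  As {n/p^ν} = (n mod p^ν)/p^ν, the N-th partial sum equals
-- (p^N s_N(n) - (n mod p^N)) / ((p - 1) p^N), so all partial sums are ≤ 1 iff s(n) ≤ p - 1.
-- By Legendre, (p - 1) ord_p(m!) = m - s(m); hence k ≡ s(k) mod p - 1, and Kummer's
-- theorem (p - 1) ord_p (n C k) = s(k) + s(n - k) - s(n).  If s(n) ≤ p - 1 and p - 1 ∣ k
-- with 0 < k < n, then s(k) ≥ p - 1 ≥ s(n) and s(n - k) ≥ 1, so p ∣ n C k.  If s(n) ≥ p,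
-- lowering the digits of n to a k with s(k) = p - 1 gives p - 1 ∣ k and p ∤ n C k.
module Submission where

open import Defs
open import Data.Nat using (ℕ; _<_; _≤_; _∸_)
open import Data.Nat.Divisibility using (_∣_)
open import Data.Nat.Primality using (Prime; prime⇒nonZero)
open import Data.Nat.Combinatorics using (_C_)
open import Data.Rational using (1ℚ) renaming (_≤_ to _≤ℚ_)
open import Function.Bundles using (_⇔_)

open import Data.Empty using (⊥-elim)
open import Data.Integer as ℤ using (-[1+_])
import Data.Integer.DivMod as ℤ
import Data.Integer.Properties as ℤ
import Data.Integer.Tactic.RingSolver as ℤ-Solver
open import Data.Nat
open import Data.Nat.Combinatorics using (nCk≡n!/k![n-k]!; k![n∸k]!∣n!)
open import Data.Nat.Divisibility
open import Data.Nat.DivMod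
open import Data.Nat.Induction using (<-rec)
open import Data.Nat.Primality using (euclidsLemma; ¬prime[0]; ¬prime[1])
open import Data.Nat.Properties
import Data.Nat.Tactic.RingSolver as ℕ-Solver
open import Data.Product using (∃-syntax; _×_; _,_)
open import Data.Rational as ℚ using (mkℚ; toℚᵘ; floor)
import Data.Rational.Properties as ℚ
open import Data.Rational.Unnormalised as ℚᵘ using (*≡*; *≤*; 1ℚᵘ)
  renaming (_/_ to _/ᵘ_; _≃_ to _≃ᵘ_; _≤_ to _≤ᵘ_; _+_ to _+ᵘ_)
import Data.Rational.Unnormalised.Properties as ℚᵘ
open import Data.Sum using (inj₁; inj₂)
open import Function.Base using (case_of_)
open import Function.Bundles using (mk⇔; module Equivalence)
import Function.Properties.Equivalence as ⇔
open import Relation.Binary.PropositionalEquality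
open import Relation.Nullary using (yes; no; contradiction)

open import Algebra.Properties.CommutativeSemigroup *-commutativeSemigroup
  using () renaming (interchange to *-interchange)

infix 4 _^_∥_

data _^_∥_ (m e x : ℕ) : Set where
  exactly : ∀ u → x ≡ m ^ e * u → m ∤ u → m ^ e ∥ x

∤⇒^0∥ : ∀ {m x} → m ∤ x → m ^ 0 ∥ x
∤⇒^0∥ {x = x} m∤x = exactly x (sym (*-identityˡ x)) m∤x

^0∥⇒∤ : ∀ {m x} → m ^ 0 ∥ x → m ∤ x
^0∥⇒∤ (exactly u refl m∤u) = subst (_ ∤_) (sym (*-identityˡ u)) m∤u

^suc∥⇒∣ : ∀ {m e x} → m ^ suc e ∥ x → m ∣ x
^suc∥⇒∣ {m} {e} (exactly u refl _) = subst (m ∣_) (sym (*-assoc m (m ^ e) u)) (m∣m*n (m ^ e * u))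

^∥-suc : ∀ {m x e} → m ^ e ∥ x → m ^ suc e ∥ m * x
^∥-suc {m} {e = e} (exactly u refl m∤u) = exactly u (sym (*-assoc m (m ^ e) u)) m∤u

^∥-* : ∀ {m a b x y} → Prime m → m ^ a ∥ x → m ^ b ∥ y → m ^ (a + b) ∥ x * y
^∥-* {m} {a} {b} m-prime (exactly u refl m∤u) (exactly v refl m∤v) = exactly (u * v) regroup m∤uv
  where
  regroup : m ^ a * u * (m ^ b * v) ≡ m ^ (a + b) * (u * v)
  regroup = begin
    m ^ a * u * (m ^ b * v)   ≡⟨ *-interchange (m ^ a) u (m ^ b) v ⟩
    m ^ a * m ^ b * (u * v)   ≡⟨ cong (_* (u * v)) (^-distribˡ-+-* m a b) ⟨
    m ^ (a + b) * (u * v)     ∎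
    where open ≡-Reasoning
  m∤uv : m ∤ u * v
  m∤uv m∣uv with euclidsLemma u v m-prime m∣uv
  ... | inj₁ m∣u = m∤u m∣u
  ... | inj₂ m∣v = m∤v m∣v

^∥-unique : ∀ {m a b x} .{{_ : NonZero m}} → m ^ a ∥ x → m ^ b ∥ x → a ≡ b
^∥-unique {a = zero}  {zero}  _ _ = refl
^∥-unique {a = zero}  {suc b} m^0∥x m^b∥x = ⊥-elim (^0∥⇒∤ m^0∥x (^suc∥⇒∣ {e = b} m^b∥x))
^∥-unique {a = suc a} {zero}  m^a∥x m^0∥x = ⊥-elim (^0∥⇒∤ m^0∥x (^suc∥⇒∣ {e = a} m^a∥x))
^∥-unique {m} {suc a} {suc b} (exactly u refl m∤u) (exactly v eq m∤v) =
  cong suc (^∥-unique (exactly u refl m∤u) (exactly v (*-cancelˡ-≡ _ _ m m^a*u≡m^b*v) m∤v))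
  where
  m^a*u≡m^b*v : m * (m ^ a * u) ≡ m * (m ^ b * v)
  m^a*u≡m^b*v = trans (sym (*-assoc m (m ^ a) u)) (trans eq (*-assoc m (m ^ b) v))

^∥-exists : ∀ {m} → 1 < m → ∀ x → 0 < x → ∃[ e ] m ^ e ∥ x
^∥-exists {m} 1<m = <-rec _ step
  where
  step : ∀ x → (∀ {y} → y < x → 0 < y → ∃[ e ] m ^ e ∥ y) → 0 < x → ∃[ e ] m ^ e ∥ x
  step x ih 0<x with m ∣? x
  ... | no  m∤x = 0 , ∤⇒^0∥ m∤x
  ... | yes (divides-refl zero) = ⊥-elim (<-irrefl refl 0<x)
  ... | yes (divides-refl q@(suc _)) with ih (m<m*n q m 1<m) z<s
  ...   | e , m^e∥q = suc e , subst (m ^ suc e ∥_) (*-comm m q) (^∥-suc m^e∥q)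

m%[n*o]≡m%o+[m/o%n]*o : ∀ m n o .{{_ : NonZero n}} .{{_ : NonZero o}} {{_ : NonZero (n * o)}} →
                        m % (n * o) ≡ m % o + m / o % n * o
m%[n*o]≡m%o+[m/o%n]*o m n o = begin
  m % (n * o)                             ≡⟨ m≡m%n+[m/n]*n (m % (n * o)) o ⟩
  m % (n * o) % o + m % (n * o) / o * o   ≡⟨ cong₂ (λ x y → x + y * o)
                                               (m∣n⇒o%n%m≡o%m o (n * o) m (n∣m*n n))
                                               (m%[n*o]/o≡m/o%n m n o) ⟩
  m % o + m / o % n * o                   ∎
  where open ≡-Reasoning

nCk*[k!*[n∸k]!]≡n! : ∀ {n k} → k ≤ n → (n C k) * (k ! * (n ∸ k) !) ≡ n !
nCk*[k!*[n∸k]!]≡n! {n} {k} k≤n =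
  trans (cong (_* (k ! * (n ∸ k) !)) (nCk≡n!/k![n-k]! k≤n)) (m/n*n≡m (k![n∸k]!∣n! k≤n))
  where instance _ = k !* (n ∸ k) !≢0

nCk>0 : ∀ {n k} → k ≤ n → 0 < n C k
nCk>0 {n} {k} k≤n = n≢0⇒n>0 λ nCk≡0 →
  <-irrefl (sym (trans (sym (nCk*[k!*[n∸k]!]≡n! k≤n)) (cong (_* (k ! * (n ∸ k) !)) nCk≡0))) (1≤n! n)

-- The base is p = P + 1 ≥ 2; taking P = p - 1 as the parameter makes p ≡ suc P definitional,
-- which the ring solver needs to relate p and p - 1.
module Digits (P : ℕ) .{{_ : NonZero P}} where

  p : ℕ
  p = suc P

  1<p : 1 < p
  1<p = s<s (>-nonZero⁻¹ P)

  partialDigitSum : ℕ → ℕ → ℕ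
  partialDigitSum zero    x = 0
  partialDigitSum (suc N) x = x % p + partialDigitSum N (x / p)

  -- x has at most x digits in base p ≥ 2.
  digitSum : ℕ → ℕ
  digitSum x = partialDigitSum x x

  partialDigitSum-zeroʳ : ∀ N → partialDigitSum N 0 ≡ 0
  partialDigitSum-zeroʳ zero    = refl
  partialDigitSum-zeroʳ (suc N) = partialDigitSum-zeroʳ N

  x≤1+N⇒x/p≤N : ∀ {x N} → x ≤ suc N → x / p ≤ N
  x≤1+N⇒x/p≤N {zero}  _     = z≤n
  x≤1+N⇒x/p≤N {suc x} x≤1+N = ≤-pred (≤-trans (m/n<m (suc x) p 1<p) x≤1+N)

  partialDigitSum-stable : ∀ {M N x} → x ≤ M → x ≤ N → partialDigitSum M x ≡ partialDigitSum N x
  partialDigitSum-stable {zero}  {N}     z≤n _   = sym (partialDigitSum-zeroʳ N)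
  partialDigitSum-stable {suc M} {zero}  _   z≤n = partialDigitSum-zeroʳ (suc M)
  partialDigitSum-stable {suc M} {suc N} {x} x≤M x≤N =
    cong (x % p +_) (partialDigitSum-stable (x≤1+N⇒x/p≤N x≤M) (x≤1+N⇒x/p≤N x≤N))

  digitSum-step : ∀ x → digitSum x ≡ x % p + digitSum (x / p)
  digitSum-step zero    = refl
  digitSum-step (suc x) = cong (suc x % p +_) (partialDigitSum-stable (x≤1+N⇒x/p≤N ≤-refl) ≤-refl)

  digitSum-cons : ∀ {a} q → a < p → digitSum (a + q * p) ≡ a + digitSum q
  digitSum-cons {a} q a<p = begin
    digitSum (a + q * p)                           ≡⟨ digitSum-step (a + q * p) ⟩
    (a + q * p) % p + digitSum ((a + q * p) / p)   ≡⟨ cong₂ _+_ a%p≡a (cong digitSum [a+q*p]/p≡q) ⟩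
    a + digitSum q                                 ∎
    where
    open ≡-Reasoning
    a%p≡a : (a + q * p) % p ≡ a
    a%p≡a = trans ([m+kn]%n≡m%n a q p) (m<n⇒m%n≡m a<p)
    noCarry : a % p + q * p % p < p
    noCarry = subst (_< p) (sym (trans (cong₂ _+_ (m<n⇒m%n≡m a<p) (m*n%n≡0 q p)) (+-identityʳ a))) a<p
    [a+q*p]/p≡q : (a + q * p) / p ≡ q
    [a+q*p]/p≡q = begin
      (a + q * p) / p       ≡⟨ +-distrib-/ a (q * p) noCarry ⟩
      a / p + q * p / p     ≡⟨ cong₂ _+_ (m<n⇒m/n≡0 a<p) (m*n/n≡m q p) ⟩
      q                     ∎

  digitSum-digit : ∀ {a} → a < p → digitSum a ≡ a
  digitSum-digit {a} a<p = begin
    digitSum a            ≡⟨ cong digitSum (+-identityʳ a) ⟨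
    digitSum (a + 0 * p)  ≡⟨ digitSum-cons 0 a<p ⟩
    a + 0                 ≡⟨ +-identityʳ a ⟩
    a                     ∎
    where open ≡-Reasoning

  digitSum-*p : ∀ q → digitSum (q * p) ≡ digitSum q
  digitSum-*p q = digitSum-cons q 0<1+n

  digitSum≡0⇒≡0 : ∀ x → digitSum x ≡ 0 → x ≡ 0
  digitSum≡0⇒≡0 = <-rec _ step
    where
    step : ∀ x → (∀ {y} → y < x → digitSum y ≡ 0 → y ≡ 0) → digitSum x ≡ 0 → x ≡ 0
    step zero      _  _       = refl
    step x@(suc _) ih sum≡0 = begin
      x                   ≡⟨ m≡m%n+[m/n]*n x p ⟩
      x % p + x / p * p   ≡⟨ cong₂ _+_ x%p≡0 (cong (_* p) (ih (m/n<m x p 1<p) sum[x/p]≡0)) ⟩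
      0                   ∎
      where
      open ≡-Reasoning
      split : x % p + digitSum (x / p) ≡ 0
      split = trans (sym (digitSum-step x)) sum≡0
      x%p≡0 : x % p ≡ 0
      x%p≡0 = m+n≡0⇒m≡0 (x % p) split
      sum[x/p]≡0 : digitSum (x / p) ≡ 0
      sum[x/p]≡0 = m+n≡0⇒n≡0 (x % p) split

  digitSum-pos : ∀ {x} → 0 < x → 0 < digitSum x
  digitSum-pos {x} 0<x = n≢0⇒n>0 (λ sum≡0 → <-irrefl (sym (digitSum≡0⇒≡0 x sum≡0)) 0<x)

  digitSum≡-mod-P : ∀ x → ∃[ c ] P * c + digitSum x ≡ x
  digitSum≡-mod-P = <-rec _ step
    where
    step : ∀ x → (∀ {y} → y < x → ∃[ c ] P * c + digitSum y ≡ y) → ∃[ c ] P * c + digitSum x ≡ x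
    step zero      _  = 0 , trans (+-identityʳ (P * 0)) (*-zeroʳ P)
    step x@(suc _) ih with ih (m/n<m x p 1<p)
    ... | c , P*c+sum≡q = q + c , (begin
      P * (q + c) + digitSum x           ≡⟨ cong (P * (q + c) +_) (digitSum-step x) ⟩
      P * (q + c) + (a + digitSum q)     ≡⟨ regroup P q c a (digitSum q) ⟩
      a + P * q + (P * c + digitSum q)   ≡⟨ cong (a + P * q +_) P*c+sum≡q ⟩
      a + P * q + q                      ≡⟨ shift a P q ⟩
      a + q * p                          ≡⟨ m≡m%n+[m/n]*n x p ⟨
      x                                  ∎)
      where
      open ≡-Reasoning
      a = x % p
      q = x / p
      regroup : ∀ P q c a s → P * (q + c) + (a + s) ≡ a + P * q + (P * c + s)
      regroup = ℕ-Solver.solve-∀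
      shift : ∀ a P q → a + P * q + q ≡ a + q * suc P
      shift = ℕ-Solver.solve-∀

  P∣⇔P∣digitSum : ∀ x → P ∣ x ⇔ P ∣ digitSum x
  P∣⇔P∣digitSum x with digitSum≡-mod-P x
  ... | c , P*c+sum≡x = mk⇔
    (λ P∣x → ∣m+n∣m⇒∣n (subst (P ∣_) (sym P*c+sum≡x) P∣x) (m∣m*n c))
    (λ P∣sum → subst (P ∣_) P*c+sum≡x (∣m∣n⇒∣m+n (m∣m*n c) P∣sum))

  -- The last conjunct says that subtracting k from n in base p involves no borrow.
  BorrowFreeSplit : ℕ → ℕ → Set
  BorrowFreeSplit n t = ∃[ k ] k ≤ n × digitSum k ≡ t × digitSum k + digitSum (n ∸ k) ≡ digitSum n

  borrowFreeSplit : ∀ n {t} → t ≤ digitSum n → BorrowFreeSplit n t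
  borrowFreeSplit = <-rec _ step
    where
    step : ∀ n → (∀ {m} → m < n → ∀ {t} → t ≤ digitSum m → BorrowFreeSplit m t) →
           ∀ {t} → t ≤ digitSum n → BorrowFreeSplit n t
    step zero      _  t≤0 = 0 , z≤n , sym (n≤0⇒n≡0 t≤0) , refl
    step n@(suc _) ih {t} t≤sum with t ≤? n % p
    ... | yes t≤a = t , ≤-trans t≤a (m%n≤m n p) , digitSum-digit t<p , (begin
      digitSum t + digitSum (n ∸ t)           ≡⟨ cong₂ _+_ (digitSum-digit t<p) (cong digitSum n∸t≡) ⟩
      t + digitSum (a ∸ t + q * p)            ≡⟨ cong (t +_) (digitSum-cons q (≤-<-trans (m∸n≤m a t) a<p)) ⟩
      t + (a ∸ t + digitSum q)                ≡⟨ +-assoc t (a ∸ t) (digitSum q) ⟨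
      t + (a ∸ t) + digitSum q                ≡⟨ cong (_+ digitSum q) (m+[n∸m]≡n t≤a) ⟩
      a + digitSum q                          ≡⟨ digitSum-step n ⟨
      digitSum n                              ∎)
      where
      open ≡-Reasoning
      a = n % p
      q = n / p
      a<p = m%n<n n p
      t<p = ≤-<-trans t≤a a<p
      n∸t≡ : n ∸ t ≡ a ∸ t + q * p
      n∸t≡ = trans (cong (_∸ t) (m≡m%n+[m/n]*n n p)) (+-∸-comm (q * p) t≤a)
    ... | no t≰a with ih (m/n<m n p 1<p) t∸a≤sum
      where
      t∸a≤sum : t ∸ n % p ≤ digitSum (n / p)
      t∸a≤sum = ≤-trans (∸-monoˡ-≤ (n % p) (≤-trans t≤sum (≤-reflexive (digitSum-step n))))
                        (≤-reflexive (m+n∸m≡n (n % p) (digitSum (n / p))))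
    ... | k , k≤q , sum[k]≡t∸a , no-borrow =
      a + k * p , k′≤n , sum[k′]≡t , (begin
      digitSum (a + k * p) + digitSum (n ∸ (a + k * p))
        ≡⟨ cong₂ _+_ (digitSum-cons k a<p) (cong digitSum n∸k′≡) ⟩
      a + digitSum k + digitSum ((q ∸ k) * p)            ≡⟨ cong (a + digitSum k +_) (digitSum-*p (q ∸ k)) ⟩
      a + digitSum k + digitSum (q ∸ k)                  ≡⟨ +-assoc a (digitSum k) (digitSum (q ∸ k)) ⟩
      a + (digitSum k + digitSum (q ∸ k))                ≡⟨ cong (a +_) no-borrow ⟩
      a + digitSum q                                     ≡⟨ digitSum-step n ⟨
      digitSum n                                         ∎)
      where
      open ≡-Reasoning
      a = n % p
      q = n / p
      a<p = m%n<n n p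
      n≡ = m≡m%n+[m/n]*n n p
      k′≤n : a + k * p ≤ n
      k′≤n = subst (a + k * p ≤_) (sym n≡) (+-monoʳ-≤ a (*-monoˡ-≤ p k≤q))
      sum[k′]≡t : digitSum (a + k * p) ≡ t
      sum[k′]≡t = trans (digitSum-cons k a<p)
                        (trans (cong (a +_) sum[k]≡t∸a) (m+[n∸m]≡n (<⇒≤ (≰⇒> t≰a))))
      n∸k′≡ : n ∸ (a + k * p) ≡ (q ∸ k) * p
      n∸k′≡ = trans (cong (_∸ (a + k * p)) n≡)
                    (trans ([m+n]∸[m+o]≡n∸o a (q * p) (k * p)) (sym (*-distribʳ-∸ p q k)))

  p∤a+q*p : ∀ {a} q → 0 < a → a < p → p ∤ a + q * p
  p∤a+q*p {a} q 0<a a<p p∣a+q*p =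
    <⇒≱ a<p (∣⇒≤ {{>-nonZero 0<a}} (∣m+n∣m⇒∣n (subst (p ∣_) (+-comm a (q * p)) p∣a+q*p) (n∣m*n q)))

  -- t is the number of trailing digits p - 1 of m, which all turn into 0 in m + 1.
  digitSum-suc : ∀ m → ∃[ t ] p ^ t ∥ suc m × digitSum (suc m) + P * t ≡ digitSum m + 1
  digitSum-suc = <-rec _ step
    where
    step : ∀ m → (∀ {k} → k < m → ∃[ t ] p ^ t ∥ suc k × digitSum (suc k) + P * t ≡ digitSum k + 1) →
           ∃[ t ] p ^ t ∥ suc m × digitSum (suc m) + P * t ≡ digitSum m + 1
    step m ih with m % p ≟ P
    ... | no m%p≢P = 0 , ∤⇒^0∥ p∤1+m , (begin
      digitSum (suc m) + P * 0      ≡⟨ cong (digitSum (suc m) +_) (*-zeroʳ P) ⟩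
      digitSum (suc m) + 0          ≡⟨ +-identityʳ (digitSum (suc m)) ⟩
      digitSum (suc m)              ≡⟨ cong digitSum 1+m≡ ⟩
      digitSum (suc a + q * p)      ≡⟨ digitSum-cons q 1+a<p ⟩
      suc (a + digitSum q)          ≡⟨ cong suc (digitSum-step m) ⟨
      suc (digitSum m)              ≡⟨ +-comm 1 (digitSum m) ⟩
      digitSum m + 1                ∎)
      where
      open ≡-Reasoning
      a = m % p
      q = m / p
      1+a<p : suc a < p
      1+a<p = s<s (≤∧≢⇒< (≤-pred (m%n<n m p)) m%p≢P)
      1+m≡ : suc m ≡ suc a + q * p
      1+m≡ = cong suc (m≡m%n+[m/n]*n m p)
      p∤1+m : p ∤ suc m
      p∤1+m = subst (p ∤_) (sym 1+m≡) (p∤a+q*p q z<s 1+a<p)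
    ... | yes m%p≡P with ih (m/n<m m p {{>-nonZero 0<m}} 1<p)
      where
      0<m : 0 < m
      0<m = n≢0⇒n>0 (λ m≡0 → ≢-nonZero⁻¹ P (trans (sym m%p≡P) (cong (_% p) m≡0)))
    ...   | t , p^t∥1+q , carry = suc t , p^[1+t]∥1+m , (begin
      digitSum (suc m) + P * suc t      ≡⟨ cong (λ x → digitSum x + P * suc t) 1+m≡ ⟩
      digitSum (suc q * p) + P * suc t  ≡⟨ cong (_+ P * suc t) (digitSum-*p (suc q)) ⟩
      digitSum (suc q) + P * suc t      ≡⟨ peel (digitSum (suc q)) P t ⟩
      digitSum (suc q) + P * t + P      ≡⟨ cong (_+ P) carry ⟩
      digitSum q + 1 + P                ≡⟨ cong (digitSum q + 1 +_) m%p≡P ⟨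
      digitSum q + 1 + m % p            ≡⟨ reorder (digitSum q) (m % p) ⟩
      m % p + digitSum q + 1            ≡⟨ cong (_+ 1) (digitSum-step m) ⟨
      digitSum m + 1                    ∎)
      where
      open ≡-Reasoning
      q = m / p
      1+m≡ : suc m ≡ suc q * p
      1+m≡ = cong suc (trans (m≡m%n+[m/n]*n m p) (cong (_+ q * p) m%p≡P))
      p^[1+t]∥1+m : p ^ suc t ∥ suc m
      p^[1+t]∥1+m = subst (p ^ suc t ∥_) (trans (*-comm p (suc q)) (sym 1+m≡)) (^∥-suc p^t∥1+q)
      peel : ∀ s P t → s + P * suc t ≡ s + P * t + P
      peel = ℕ-Solver.solve-∀
      reorder : ∀ s a → s + 1 + a ≡ a + s + 1
      reorder = ℕ-Solver.solve-∀

  module _ (p-prime : Prime p) where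

    legendre : ∀ m → ∃[ L ] p ^ L ∥ m ! × P * L + digitSum m ≡ m
    legendre zero    = 0 , ∤⇒^0∥ (λ p∣1 → <⇒≱ 1<p (∣⇒≤ p∣1)) , trans (+-identityʳ (P * 0)) (*-zeroʳ P)
    legendre (suc m) with digitSum-suc m | legendre m
    ... | t , p^t∥1+m , carry | L , p^L∥m! , P*L+sum≡m = t + L , ^∥-* p-prime p^t∥1+m p^L∥m! , (begin
      P * (t + L) + digitSum (suc m)       ≡⟨ regroup P t L (digitSum (suc m)) ⟩
      digitSum (suc m) + P * t + P * L     ≡⟨ cong (_+ P * L) carry ⟩
      digitSum m + 1 + P * L               ≡⟨ shift (digitSum m) (P * L) ⟩
      1 + (P * L + digitSum m)             ≡⟨ cong suc P*L+sum≡m ⟩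
      suc m                                ∎)
      where
      open ≡-Reasoning
      regroup : ∀ P t L s → P * (t + L) + s ≡ s + P * t + P * L
      regroup = ℕ-Solver.solve-∀
      shift : ∀ s x → s + 1 + x ≡ 1 + (x + s)
      shift = ℕ-Solver.solve-∀

    kummer : ∀ {n k} → k ≤ n → ∃[ e ] p ^ e ∥ n C k × P * e + digitSum n ≡ digitSum k + digitSum (n ∸ k)
    kummer {n} {k} k≤n with ^∥-exists 1<p (n C k) (nCk>0 k≤n) | legendre k | legendre (n ∸ k) | legendre n
    ... | e , p^e∥C | a , p^a∥k! , P*a+sum≡k | b , p^b∥j! , P*b+sum≡j | L , p^L∥n! , P*L+sum≡n =
      e , p^e∥C , +-cancelˡ-≡ (P * (a + b)) _ _ (begin
      P * (a + b) + (P * e + digitSum n)                       ≡⟨ regroup₁ P a b e (digitSum n) ⟩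
      P * (e + (a + b)) + digitSum n                           ≡⟨ cong (λ x → P * x + digitSum n) e+a+b≡L ⟩
      P * L + digitSum n                                       ≡⟨ P*L+sum≡n ⟩
      n                                                        ≡⟨ m+[n∸m]≡n k≤n ⟨
      k + (n ∸ k)                                              ≡⟨ cong₂ _+_ P*a+sum≡k P*b+sum≡j ⟨
      P * a + digitSum k + (P * b + digitSum (n ∸ k))          ≡⟨ regroup₂ P a b (digitSum k) (digitSum (n ∸ k)) ⟩
      P * (a + b) + (digitSum k + digitSum (n ∸ k))            ∎)
      where
      open ≡-Reasoning
      e+a+b≡L : e + (a + b) ≡ L
      e+a+b≡L = ^∥-unique (subst (p ^ (e + (a + b)) ∥_) (nCk*[k!*[n∸k]!]≡n! k≤n)
                  (^∥-* p-prime p^e∥C (^∥-* p-prime p^a∥k! p^b∥j!))) p^L∥n!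
      regroup₁ : ∀ P a b e s → P * (a + b) + (P * e + s) ≡ P * (e + (a + b)) + s
      regroup₁ = ℕ-Solver.solve-∀
      regroup₂ : ∀ P a b x y → P * a + x + (P * b + y) ≡ P * (a + b) + (x + y)
      regroup₂ = ℕ-Solver.solve-∀

    -- s(k) + s(n ∸ k) - s(n) is p - 1 times the number of carries in adding k and n ∸ k.
    p∣nCk⇔carry : ∀ {n k} → k ≤ n → p ∣ n C k ⇔ digitSum n < digitSum k + digitSum (n ∸ k)
    p∣nCk⇔carry {n} k≤n with kummer k≤n
    ... | zero , p^0∥C , P*0+sum≡ = mk⇔
      (λ p∣C → contradiction p∣C (^0∥⇒∤ p^0∥C))
      (λ sum< → contradiction (trans (sym (cong (_+ digitSum n) (*-zeroʳ P))) P*0+sum≡) (<⇒≢ sum<))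
    ... | suc e , p^e∥C , P*e+sum≡ = mk⇔
      (λ _ → subst (digitSum n <_) P*e+sum≡ (m<n+m (digitSum n) (>-nonZero⁻¹ (P * suc e) {{m*n≢0 P (suc e)}})))
      (λ _ → ^suc∥⇒∣ p^e∥C)

    digitSum≤P⇒p∣nCk : ∀ {n k} → digitSum n ≤ P → 0 < k → k < n → P ∣ k → p ∣ n C k
    digitSum≤P⇒p∣nCk {n} {k} sum≤P 0<k k<n P∣k = Equivalence.from (p∣nCk⇔carry (<⇒≤ k<n)) (begin-strict
      digitSum n                       ≤⟨ sum≤P ⟩
      P                                ≤⟨ ∣⇒≤ {{>-nonZero (digitSum-pos 0<k)}} (Equivalence.to (P∣⇔P∣digitSum k) P∣k) ⟩
      digitSum k                       <⟨ m<m+n (digitSum k) (digitSum-pos (m<n⇒0<n∸m k<n)) ⟩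
      digitSum k + digitSum (n ∸ k)    ∎)
      where open ≤-Reasoning

    P<digitSum⇒p∤nCk : ∀ {n} → P < digitSum n → ∃[ k ] 0 < k × k < n × P ∣ k × p ∤ n C k
    P<digitSum⇒p∤nCk {n} P<sum with borrowFreeSplit n (<⇒≤ P<sum)
    ... | k , k≤n , sum[k]≡P , no-borrow = k , 0<k , k<n , P∣k , p∤C
      where
      0<k : 0 < k
      0<k = n≢0⇒n>0 (λ k≡0 → ≢-nonZero⁻¹ P (trans (sym sum[k]≡P) (cong digitSum k≡0)))
      k<n : k < n
      k<n = m∸n≢0⇒n<m λ n∸k≡0 → <-irrefl (begin
        P                               ≡⟨ sum[k]≡P ⟨
        digitSum k                      ≡⟨ +-identityʳ (digitSum k) ⟨
        digitSum k + 0                  ≡⟨ cong (λ x → digitSum k + digitSum x) n∸k≡0 ⟨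
        digitSum k + digitSum (n ∸ k)   ≡⟨ no-borrow ⟩
        digitSum n                      ∎) P<sum
        where open ≡-Reasoning
      P∣k : P ∣ k
      P∣k = Equivalence.from (P∣⇔P∣digitSum k) (subst (P ∣_) (sym sum[k]≡P) ∣-refl)
      p∤C : p ∤ n C k
      p∤C p∣C = <-irrefl (sym no-borrow) (Equivalence.to (p∣nCk⇔carry k≤n) p∣C)

    digitSum≤P⇔p∣nCk : ∀ n → digitSum n ≤ P ⇔ (∀ k → 0 < k → k < n → P ∣ k → p ∣ n C k)
    digitSum≤P⇔p∣nCk n = mk⇔
      (λ sum≤P k → digitSum≤P⇒p∣nCk {n} {k} sum≤P)
      (λ p∣nCk → ≮⇒≥ λ P<sum → case P<digitSum⇒p∤nCk {n} P<sum of λ where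
        (k , 0<k , k<n , P∣k , p∤C) → p∤C (p∣nCk k 0<k k<n P∣k))

  p^≢0 : ∀ N → NonZero (p ^ N)
  p^≢0 N = m^n≢0 p N

  n<p^n : ∀ n → n < p ^ n
  n<p^n zero    = z<s
  n<p^n (suc n) = subst (suc n <_) (*-comm (p ^ n) p) (≤-trans (s≤s (n<p^n n)) (m<m*n (p ^ n) p {{p^≢0 n}} 1<p))

  partialDigitSum-suc : ∀ N x → partialDigitSum (suc N) x ≡ partialDigitSum N x + (x / p ^ N) {{p^≢0 N}} % p
  partialDigitSum-suc zero    x = trans (+-identityʳ (x % p)) (cong (_% p) (sym (n/1≡n x)))
  partialDigitSum-suc (suc N) x = begin
    x % p + partialDigitSum (suc N) (x / p)                  ≡⟨ cong (x % p +_) (partialDigitSum-suc N (x / p)) ⟩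
    x % p + (partialDigitSum N (x / p) + x / p / p ^ N % p)   ≡⟨ +-assoc (x % p) _ _ ⟨
    partialDigitSum (suc N) x + x / p / p ^ N % p
      ≡⟨ cong (λ y → partialDigitSum (suc N) x + y % p) (m/n/o≡m/[n*o] x p (p ^ N)) ⟩
    partialDigitSum (suc N) x + x / p ^ suc N % p            ∎
    where
    open ≡-Reasoning
    instance
      _ = p^≢0 N
      _ = p^≢0 (suc N)

  partialDigitSum-mono-≤ : ∀ {M N} x → M ≤ N → partialDigitSum M x ≤ partialDigitSum N x
  partialDigitSum-mono-≤ x M≤N = mono (≤⇒≤′ M≤N)
    where
    mono : ∀ {M N} → M ≤′ N → partialDigitSum M x ≤ partialDigitSum N x
    mono ≤′-refl            = ≤-refl
    mono (≤′-step {N} M≤′N) =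
      ≤-trans (mono M≤′N) (≤-trans (m≤m+n _ _) (≤-reflexive (sym (partialDigitSum-suc N x))))

  partialDigitSum≤digitSum : ∀ N x → partialDigitSum N x ≤ digitSum x
  partialDigitSum≤digitSum N x with N ≤? x
  ... | yes N≤x = partialDigitSum-mono-≤ x N≤x
  ... | no  N≰x = ≤-reflexive (partialDigitSum-stable (<⇒≤ (≰⇒> N≰x)) ≤-refl)

  partialSumNumerator : ℕ → ℕ → ℕ
  partialSumNumerator n zero    = 0
  partialSumNumerator n (suc N) = p * partialSumNumerator n N + (n % p ^ suc N) {{p^≢0 (suc N)}}

  numerator-partialDigitSum : ∀ n N →
    P * partialSumNumerator n N + (n % p ^ N) {{p^≢0 N}} ≡ p ^ N * partialDigitSum N n
  numerator-partialDigitSum n zero    = cong₂ _+_ (*-zeroʳ P) (n%1≡0 n)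
  numerator-partialDigitSum n (suc N) = begin
    P * (p * A + r′) + r′
      ≡⟨ cong (λ x → P * (p * A + x) + x) (m%[n*o]≡m%o+[m/o%n]*o n p (p ^ N)) ⟩
    P * (p * A + (r + d * D)) + (r + d * D)   ≡⟨ regroup P A r d D ⟩
    p * (P * A + r + d * D)                   ≡⟨ cong (λ x → p * (x + d * D)) (numerator-partialDigitSum n N) ⟩
    p * (D * partialDigitSum N n + d * D)     ≡⟨ factor p D (partialDigitSum N n) d ⟩
    p * D * (partialDigitSum N n + d)         ≡⟨ cong (p * D *_) (partialDigitSum-suc N n) ⟨
    p * D * partialDigitSum (suc N) n         ∎
    where
    open ≡-Reasoning
    instance
      _ = p^≢0 N
      _ = p^≢0 (suc N)
    A = partialSumNumerator n N
    D = p ^ N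
    r = n % D
    r′ = n % p ^ suc N
    d = n / D % p
    regroup : ∀ P A r d D → P * (suc P * A + (r + d * D)) + (r + d * D) ≡ suc P * (P * A + r + d * D)
    regroup = ℕ-Solver.solve-∀
    factor : ∀ p D s d → p * (D * s + d * D) ≡ p * D * (s + d)
    factor = ℕ-Solver.solve-∀

  numerator≤p^N⇔digitSum≤P : ∀ n → (∀ N → partialSumNumerator n N ≤ p ^ N) ⇔ digitSum n ≤ P
  numerator≤p^N⇔digitSum≤P n = mk⇔ bounded⇒digitSum≤P digitSum≤P⇒bounded
    where
    open ≤-Reasoning
    bounded⇒digitSum≤P : (∀ N → partialSumNumerator n N ≤ p ^ N) → digitSum n ≤ P
    bounded⇒digitSum≤P bounded = ≤-pred (*-cancelˡ-< (p ^ n) (digitSum n) p (begin-strict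
      p ^ n * digitSum n                                  ≡⟨ numerator-partialDigitSum n n ⟨
      P * partialSumNumerator n n + n % p ^ n             ≡⟨ cong (P * partialSumNumerator n n +_) (m<n⇒m%n≡m (n<p^n n)) ⟩
      P * partialSumNumerator n n + n                     <⟨ +-mono-≤-< (*-monoʳ-≤ P (bounded n)) (n<p^n n) ⟩
      P * p ^ n + p ^ n                                   ≡⟨ +-comm (P * p ^ n) (p ^ n) ⟩
      p * p ^ n                                           ≡⟨ *-comm p (p ^ n) ⟩
      p ^ n * p                                           ∎))
      where instance _ = p^≢0 n
    digitSum≤P⇒bounded : digitSum n ≤ P → ∀ N → partialSumNumerator n N ≤ p ^ N
    digitSum≤P⇒bounded digitSum≤P N = *-cancelˡ-≤ P (begin
      P * partialSumNumerator n N                         ≤⟨ m≤m+n _ _ ⟩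
      P * partialSumNumerator n N + n % p ^ N             ≡⟨ numerator-partialDigitSum n N ⟩
      p ^ N * partialDigitSum N n                         ≤⟨ *-monoʳ-≤ (p ^ N) (≤-trans (partialDigitSum≤digitSum N n) digitSum≤P) ⟩
      p ^ N * P                                           ≡⟨ *-comm (p ^ N) P ⟩
      P * p ^ N                                           ∎)
      where instance _ = p^≢0 N

-- Opened only now: the prefix operator +_ makes sections (x +_) above ambiguous.
open import Data.Integer using (+_)

floor-≃ : ∀ q n d .{{_ : NonZero d}} → toℚᵘ q ≃ᵘ + n /ᵘ d → floor q ≡ + (n / d)
floor-≃ (mkℚ (+ a) b-1 _) n d@(suc _) (*≡* a*d≡n*b) =
  trans (ℤ.*-identityˡ (+ (a / b))) (cong +_ a/b≡n/d)
  where
  open ≡-Reasoning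
  b = suc b-1
  a*d≡n*b′ : a * d ≡ n * b
  a*d≡n*b′ = ℤ.+-injective (trans (ℤ.pos-* a d) (trans a*d≡n*b (sym (ℤ.pos-* n b))))
  a/b≡n/d : a / b ≡ n / d
  a/b≡n/d = begin
    a / b             ≡⟨ m*n/o*n≡m/o a d b ⟨
    a * d / (b * d)   ≡⟨ /-congˡ a*d≡n*b′ ⟩
    n * b / (b * d)   ≡⟨ /-congʳ {m = n * b} (*-comm b d) ⟩
    n * b / (d * b)   ≡⟨ m*n/o*n≡m/o n b d ⟩
    n / d             ∎
floor-≃ (mkℚ -[1+ _ ] _ _) zero    (suc _) (*≡* ())
floor-≃ (mkℚ -[1+ _ ] _ _) (suc _) (suc _) (*≡* ())

n/d-[n/d]≃[n%d]/d : ∀ n d .{{_ : NonZero d}} → + n /ᵘ d +ᵘ ℚᵘ.- (+ (n / d) /ᵘ 1) ≃ᵘ + (n % d) /ᵘ d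
n/d-[n/d]≃[n%d]/d n d@(suc d-1) = *≡* (begin
  (+ n ℤ.* + 1 ℤ.+ ℤ.- + k ℤ.* + d) ℤ.* + d
    ≡⟨ cong (λ m → (m ℤ.* + 1 ℤ.+ ℤ.- + k ℤ.* + d) ℤ.* + d) (ℤ.a≡a%ℕn+[a/ℕn]*n (+ n) d) ⟩
  ((+ r ℤ.+ + k ℤ.* + d) ℤ.* + 1 ℤ.+ ℤ.- + k ℤ.* + d) ℤ.* + d
    ≡⟨ cancel (+ r) (+ k) (+ d) ⟩
  + r ℤ.* + d
    ≡⟨ cong (λ m → + r ℤ.* + suc m) (*-identityʳ d-1) ⟨
  + r ℤ.* + suc (d-1 * 1) ∎)
  where
  open ≡-Reasoning
  k = n / d
  r = n % d
  cancel : ∀ r k d → ((r ℤ.+ k ℤ.* d) ℤ.* ℤ.1ℤ ℤ.+ ℤ.- k ℤ.* d) ℤ.* d ≡ r ℤ.* d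
  cancel = ℤ-Solver.solve-∀

frac-/ : ∀ n d .{{_ : NonZero d}} → toℚᵘ (frac (+ n ℚ./ d)) ≃ᵘ + (n % d) /ᵘ d
frac-/ n d@(suc _) = begin
  toℚᵘ (x ℚ.+ ℚ.- (floor x ℚ./ 1))       ≈⟨ ℚ.toℚᵘ-homo-+ x _ ⟩
  toℚᵘ x +ᵘ toℚᵘ (ℚ.- (floor x ℚ./ 1))   ≈⟨ ℚᵘ.+-cong x≃n/d (ℚᵘ.≃-trans (ℚ.toℚᵘ-homo‿- _) (ℚᵘ.-‿cong ⌊x⌋≃n/d)) ⟩
  + n /ᵘ d +ᵘ ℚᵘ.- (+ (n / d) /ᵘ 1)      ≈⟨ n/d-[n/d]≃[n%d]/d n d ⟩
  + (n % d) /ᵘ d                         ∎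
  where
  open ℚᵘ.≃-Reasoning
  x = + n ℚ./ d
  x≃n/d : toℚᵘ x ≃ᵘ + n /ᵘ d
  x≃n/d = ℚ.toℚᵘ-fromℚᵘ (+ n /ᵘ d)
  ⌊x⌋≃n/d : toℚᵘ (floor x ℚ./ 1) ≃ᵘ + (n / d) /ᵘ 1
  ⌊x⌋≃n/d rewrite floor-≃ x n d x≃n/d = ℚ.toℚᵘ-fromℚᵘ (+ (n / d) /ᵘ 1)

/ᵘ-+-/ᵘ : ∀ a r c d .{{_ : NonZero d}} .{{_ : NonZero (c * d)}} →
          + a /ᵘ d +ᵘ + r /ᵘ (c * d) ≃ᵘ + (c * a + r) /ᵘ (c * d)
/ᵘ-+-/ᵘ a r c@(suc _) d@(suc _) = *≡* (begin
  (+ a ℤ.* + (c * d) ℤ.+ + r ℤ.* + d) ℤ.* + (c * d)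
    ≡⟨ cong (ℤ._* + (c * d)) (cong₂ ℤ._+_ (ℤ.pos-* a (c * d)) (ℤ.pos-* r d)) ⟨
  (+ (a * (c * d)) ℤ.+ + (r * d)) ℤ.* + (c * d)
    ≡⟨ cong (ℤ._* + (c * d)) (ℤ.pos-+ (a * (c * d)) (r * d)) ⟨
  + (a * (c * d) + r * d) ℤ.* + (c * d)
    ≡⟨ ℤ.pos-* (a * (c * d) + r * d) (c * d) ⟨
  + ((a * (c * d) + r * d) * (c * d))
    ≡⟨ cong +_ (common-denominator a r c d) ⟩
  + ((c * a + r) * (d * (c * d)))
    ≡⟨ ℤ.pos-* (c * a + r) (d * (c * d)) ⟩
  + (c * a + r) ℤ.* + (d * (c * d)) ∎)
  where
  open ≡-Reasoning
  common-denominator : ∀ a r c d → (a * (c * d) + r * d) * (c * d) ≡ (c * a + r) * (d * (c * d))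
  common-denominator = ℕ-Solver.solve-∀

/ᵘ≤1⇔≤ : ∀ a d .{{_ : NonZero d}} → + a /ᵘ d ≤ᵘ 1ℚᵘ ⇔ a ≤ d
/ᵘ≤1⇔≤ a d@(suc _) = mk⇔
  (λ { (*≤* a*1≤1*d) → ℤ.drop‿+≤+ (subst₂ ℤ._≤_ (ℤ.*-identityʳ (+ a)) (ℤ.*-identityˡ (+ d)) a*1≤1*d) })
  (λ a≤d → *≤* (subst₂ ℤ._≤_ (sym (ℤ.*-identityʳ (+ a))) (sym (ℤ.*-identityˡ (+ d))) (ℤ.+≤+ a≤d)))

module PartialSums (P : ℕ) .{{_ : NonZero P}} where

  open Digits P

  partialSum≃numerator/p^N : ∀ n N →
    toℚᵘ (partialSum n p N) ≃ᵘ (+ partialSumNumerator n N /ᵘ p ^ N) {{p^≢0 N}}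
  partialSum≃numerator/p^N n zero    = ℚᵘ.≃-refl
  partialSum≃numerator/p^N n (suc N) = begin
    toℚᵘ (partialSum n p N ℚ.+ term n p (suc N))         ≈⟨ ℚ.toℚᵘ-homo-+ (partialSum n p N) _ ⟩
    toℚᵘ (partialSum n p N) +ᵘ toℚᵘ (term n p (suc N))   ≈⟨ ℚᵘ.+-cong (partialSum≃numerator/p^N n N) (frac-/ n _) ⟩
    + A /ᵘ p ^ N +ᵘ + (n % p ^ suc N) /ᵘ p ^ suc N       ≈⟨ /ᵘ-+-/ᵘ A (n % p ^ suc N) p (p ^ N) ⟩
    + partialSumNumerator n (suc N) /ᵘ p ^ suc N         ∎
    where
    open ℚᵘ.≃-Reasoning
    instance
      _ = p^≢0 N
      _ = p^≢0 (suc N)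
    A = partialSumNumerator n N

  partialSum≤1⇔numerator≤p^N : ∀ n N → partialSum n p N ≤ℚ 1ℚ ⇔ partialSumNumerator n N ≤ p ^ N
  partialSum≤1⇔numerator≤p^N n N = mk⇔
    (λ ≤1 → to (ℚᵘ.≤-respˡ-≃ (partialSum≃numerator/p^N n N) (ℚ.toℚᵘ-mono-≤ ≤1)))
    (λ ≤p^N → ℚ.toℚᵘ-cancel-≤ (ℚᵘ.≤-respˡ-≃ (ℚᵘ.≃-sym (partialSum≃numerator/p^N n N)) (from ≤p^N)))
    where open Equivalence (/ᵘ≤1⇔≤ (partialSumNumerator n N) (p ^ N) {{p^≢0 N}})

  partialSums≤1⇔digitSum≤P : ∀ n → (∀ N → partialSum n p N ≤ℚ 1ℚ) ⇔ digitSum n ≤ P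
  partialSums≤1⇔digitSum≤P n = mk⇔
    (λ ≤1 → to (numerator≤p^N⇔digitSum≤P n) (λ N → to (partialSum≤1⇔numerator≤p^N n N) (≤1 N)))
    (λ ≤P N → from (partialSum≤1⇔numerator≤p^N n N) (from (numerator≤p^N⇔digitSum≤P n) ≤P N))
    where open Equivalence

lemma4 : (n p : ℕ) → 1 < n → (pp : Prime p) → p ≤ n →
    ((∀ (N : ℕ) → partialSum n p {{prime⇒nonZero pp}} N ≤ℚ 1ℚ)
      ⇔ (∀ (k : ℕ) → 0 < k → k < n → (p ∸ 1) ∣ k → p ∣ (n C k)))
lemma4 n zero          _ p-prime _ = contradiction p-prime ¬prime[0]
lemma4 n (suc zero)    _ p-prime _ = contradiction p-prime ¬prime[1]
lemma4 n (suc (suc d)) _ p-prime _ =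
  ⇔.trans (PartialSums.partialSums≤1⇔digitSum≤P (suc d) n) (Digits.digitSum≤P⇔p∣nCk (suc d) p-prime n)
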